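{- Fix a vertex $v$. Let $e_1,e_2$ be right edges in $T$, with minimal mincuts $u_{e_1}^\downarrow\setminus l_{e_1}^\downarrow$ and $u_{e_2}^\downarrow\setminus l_{e_2}^\downarrow$ respectively, such that all endpoints of $e_1$ and $e_2$ lie in $v^\downarrow$, and such that $l_{e_1},l_{e_2}\notin v^\downarrow$ and $u_{e_1},u_{e_2}\in v^\Uparrow$. Then $[u_{e_1},l_{e_1}]=[u_{e_2},l_{e_2}]$.
   Context: $G=(V,E,w)$ is an undirected graph with nonnegative weights, root $r$, and $T$ a spanning tree rooted at $r$. $v^\downarrow$ is the set of descendants of $v$ in $T$ (including $v$) and $v^\Uparrow$ the set of strict ancestors. Cuts are identified with the side not containing $r$; size is the number of vertices; a mincut is a cut of minimum weight. The minimal mincut of an edge is the least-size mincut containing both endpoints. An edge is a right edge in $T$ if its minimal mincut exists and is of the form $u^\downarrow\setminus l^\downarrow$ with $l$ a strict descendant of $u$. $[a,b]$ denotes the set of vertices on the tree path between $a$ and $b$.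
   Formalization: The edge weights of G take values in the nonnegative rationals. -}

module Defs where

open import Data.Nat using (ℕ; zero; suc) renaming (_≤_ to _ℕ≤_)
open import Data.Fin using (Fin; zero; suc)
open import Data.Fin.Subset using (Subset; _∈_; _∉_; ∣_∣; Nonempty)
open import Data.Fin.Subset.Properties using (_∈?_)
open import Data.Rational using (ℚ; 0ℚ; _+_; _≤_)
open import Data.Product using (Σ; ∃; _×_; _,_)
open import Data.Sum using (_⊎_)
open import Relation.Nullary using (¬_; yes; no)
open import Relation.Binary.PropositionalEquality using (_≡_; _≢_)

-- Undirected weighted (multi)graph on vertex set Fin n: m edges,
-- edge i has endpoints src i, tgt i and nonnegative weight w i.
record Graph (n : ℕ) : Set where
  field
    m    : ℕ
    src  : Fin m → Fin n
    tgt  : Fin m → Fin n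
    w    : Fin m → ℚ
    w≥0  : ∀ i → 0ℚ ≤ w i
open Graph public

iter : ∀ {n} → (Fin n → Fin n) → ℕ → Fin n → Fin n
iter f zero    x = x
iter f (suc k) x = f (iter f k x)

-- A spanning tree of G rooted at r, given by parent pointers:
-- the root is its own parent, every vertex reaches r by following parents,
-- and every tree edge {v, parent v} (v ≠ r) is an edge of G.
record RootedSpanningTree {n : ℕ} (G : Graph n) (r : Fin n) : Set where
  field
    parent      : Fin n → Fin n
    parent-root : parent r ≡ r
    reaches     : ∀ v → ∃ λ k → iter parent k v ≡ r
    tree-edge   : ∀ v → v ≢ r → ∃ λ (i : Fin (m G)) →
                    (src G i ≡ v × tgt G i ≡ parent v) ⊎ (src G i ≡ parent v × tgt G i ≡ v)
open RootedSpanningTree public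


-- x ∈ v↓ (descendants of v in T, including v)
InDesc : ∀ {n} {G : Graph n} {r} → RootedSpanningTree G r → Fin n → Fin n → Set
InDesc T x v = ∃ λ k → iter (parent T) k x ≡ v

-- u ∈ v⇑ (strict ancestors of v in T)
InStrictAnc : ∀ {n} {G : Graph n} {r} → RootedSpanningTree G r → Fin n → Fin n → Set
InStrictAnc T u v = InDesc T v u × u ≢ v

StrictDesc : ∀ {n} {G : Graph n} {r} → RootedSpanningTree G r → Fin n → Fin n → Set
StrictDesc T l u = InDesc T l u × l ≢ u

-- x ∈ [a , b] : vertex on the tree path between a and b, i.e.
-- x is an ancestor-or-self of a or of b, and x is a descendant of every
-- common ancestor of a and b (i.e. of their lowest common ancestor).
OnPath : ∀ {n} {G : Graph n} {r} → RootedSpanningTree G r → Fin n → Fin n → Fin n → Set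
OnPath T a b x = (InDesc T a x ⊎ InDesc T b x)
               × (∀ y → InDesc T a y → InDesc T b y → InDesc T x y)

sumFin : (m : ℕ) → (Fin m → ℚ) → ℚ
sumFin zero    f = 0ℚ
sumFin (suc m) f = f zero + sumFin m (λ i → f (suc i))

crossW : ∀ {n} (G : Graph n) → Subset n → Fin (m G) → ℚ
crossW G S i with src G i ∈? S | tgt G i ∈? S
... | yes _ | yes _ = 0ℚ
... | no  _ | no  _ = 0ℚ
... | yes _ | no  _ = w G i
... | no  _ | yes _ = w G i

cutWeight : ∀ {n} (G : Graph n) → Subset n → ℚ
cutWeight G S = sumFin (m G) (crossW G S)

-- a cut is identified with its side S not containing the root (S nonempty)
IsCut : ∀ {n} → Fin n → Subset n → Set
IsCut r S = r ∉ S × Nonempty S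

IsMincut : ∀ {n} → Graph n → Fin n → Subset n → Set
IsMincut G r S = IsCut r S × (∀ S′ → IsCut r S′ → cutWeight G S ≤ cutWeight G S′)

IsMinimalMincut : ∀ {n} (G : Graph n) → Fin n → Fin (m G) → Subset n → Set
IsMinimalMincut G r i S =
  IsMincut G r S × src G i ∈ S × tgt G i ∈ S ×
  (∀ S′ → IsMincut G r S′ → src G i ∈ S′ → tgt G i ∈ S′ → ∣ S ∣ ℕ≤ ∣ S′ ∣)

IsRightEdgeWith : ∀ {n} {G : Graph n} {r} → RootedSpanningTree G r →
                  Fin (m G) → Fin n → Fin n → Set
IsRightEdgeWith {n} {G = G} {r} T i u l =
  Σ (Subset n) λ S → IsMinimalMincut G r i S × StrictDesc T l u ×
    (∀ x → (x ∈ S → InDesc T x u × ¬ InDesc T x l) × (InDesc T x u × ¬ InDesc T x l → x ∈ S))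

{-# OPTIONS --safe #-}
module Submission where

-- Both minimal mincuts contain v↓: each is uᵢ↓ ∖ lᵢ↓ with v ∈ uᵢ↓, and lᵢ↓ misses v↓ because lᵢ
-- is not below v by hypothesis and not above v since eᵢ has an endpoint in v↓ outside lᵢ↓. So each
-- minimal mincut contains both endpoints of the other edge. By submodularity of the cut weight, two
-- intersecting mincuts meet in a mincut, so the minimal mincut of an edge lies inside every mincut
-- containing that edge; hence the two minimal mincuts coincide. Finally u↓ ∖ l↓ determines its top
-- u and the removed subtree root l, so the two tree paths are the same.

open import Defs
open import Data.Nat using (ℕ)
open import Data.Fin using (Fin; zero; suc; _≟_)
open import Data.Product using (_×_; ∃; _,_; proj₁; proj₂)
open import Relation.Nullary using (¬_; does; yes; no)

open import Algebra.Bundles using (CommutativeMonoid)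
open import Data.Bool using (Bool; true; false; _∧_; _∨_; _xor_; if_then_else_)
open import Data.Empty using (⊥-elim)
open import Data.Fin.Subset using (Subset; _∈_; _⊆_; ∣_∣; Nonempty; _∩_; _∪_; inside; outside)
open import Data.Fin.Subset.Properties using (_∈?_; x∈p∩q⁺; x∈p∩q⁻; x∈p∪q⁺; x∈p∪q⁻; p∩q⊆p; p⊂q⇒∣p∣<∣q∣)
import Data.Nat as ℕ
import Data.Nat.Properties as ℕ
open import Data.Rational using (ℚ; 0ℚ; _+_; _≤_; -_)
open import Data.Rational.Properties
  using (≤-refl; ≤-trans; ≤-reflexive; +-mono-≤; +-monoˡ-≤; +-monoʳ-≤; +-comm; +-0-commutativeMonoid; +-0-group)
open import Data.Sum using (_⊎_; inj₁; inj₂; [_,_]′)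
open import Data.Vec using (_∷_; lookup)
open import Data.Vec.Properties using (lookup-zipWith)
open import Function using (id; _∘_)
open import Relation.Nullary.Decidable using (decidable-stable)
open import Relation.Binary.PropositionalEquality using (_≡_; refl; sym; trans; cong; cong₂; subst; subst₂; module ≡-Reasoning)
open import Algebra.Properties.CommutativeSemigroup (CommutativeMonoid.commutativeSemigroup +-0-commutativeMonoid)
  using (interchange)
open import Algebra.Properties.Group +-0-group using (//-rightDividesʳ)

module _ {n : ℕ} (f : Fin n → Fin n) where

  iter-+ : ∀ a b x → iter f (a ℕ.+ b) x ≡ iter f a (iter f b x)
  iter-+ ℕ.zero    b x = refl
  iter-+ (ℕ.suc a) b x = cong f (iter-+ a b x)

  iter-∸ : ∀ {i j} x → i ℕ.≤ j → iter f (j ℕ.∸ i) (iter f i x) ≡ iter f j x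
  iter-∸ {i} {j} x i≤j = trans (sym (iter-+ (j ℕ.∸ i) i x)) (cong (λ k → iter f k x) (ℕ.m∸n+n≡m i≤j))

  iter-fixedPoint : ∀ {z} → f z ≡ z → ∀ k → iter f k z ≡ z
  iter-fixedPoint fz≡z ℕ.zero    = refl
  iter-fixedPoint fz≡z (ℕ.suc k) = trans (cong f (iter-fixedPoint fz≡z k)) fz≡z

  iter-periodic : ∀ {p x} → iter f p x ≡ x → ∀ k → iter f (k ℕ.* p) x ≡ x
  iter-periodic fᵖx≡x ℕ.zero = refl
  iter-periodic {p} {x} fᵖx≡x (ℕ.suc k) =
    trans (iter-+ p (k ℕ.* p) x) (trans (cong (iter f p) (iter-periodic fᵖx≡x k)) fᵖx≡x)

  periodic-reaches-fixedPoint : ∀ {p x z} → iter f (ℕ.suc p) x ≡ x → f z ≡ z →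
                                ∃ (λ K → iter f K x ≡ z) → x ≡ z
  periodic-reaches-fixedPoint {p} {x} {z} cycle fz≡z (K , fᴷx≡z) = begin
    x                      ≡⟨ sym (iter-periodic cycle K) ⟩
    iter f (K ℕ.* ℕ.suc p) x ≡⟨ sym (iter-∸ x K≤Kp) ⟩
    iter f d (iter f K x)  ≡⟨ cong (iter f d) fᴷx≡z ⟩
    iter f d z             ≡⟨ iter-fixedPoint fz≡z d ⟩
    z                      ∎
    where
    open ≡-Reasoning
    K≤Kp : K ℕ.≤ K ℕ.* ℕ.suc p
    K≤Kp = ℕ.m≤m*n K (ℕ.suc p)
    d : ℕ
    d = K ℕ.* ℕ.suc p ℕ.∸ K

module _ {n : ℕ} {G : Graph n} {r : Fin n} (T : RootedSpanningTree G r) where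

  InDesc-refl : ∀ x → InDesc T x x
  InDesc-refl x = 0 , refl

  InDesc-trans : ∀ {x y z} → InDesc T x y → InDesc T y z → InDesc T x z
  InDesc-trans {x} (a , fᵃx≡y) (b , fᵇy≡z) =
    b ℕ.+ a , trans (iter-+ (parent T) b a x) (trans (cong (iter (parent T) b) fᵃx≡y) fᵇy≡z)

  -- Mutual descendants lie on a cycle of the parent map, and a periodic point reaching the root is the root.
  InDesc-antisym : ∀ {x y} → InDesc T x y → InDesc T y x → x ≡ y
  InDesc-antisym (ℕ.zero , x≡y) _ = x≡y
  InDesc-antisym {x} {y} (ℕ.suc a , fᵃ⁺¹x≡y) (b , fᵇy≡x) = trans x≡r (sym y≡r)
    where
    y≡r : y ≡ r
    y≡r = periodic-reaches-fixedPoint (parent T) {p = a ℕ.+ b}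
            (trans (iter-+ (parent T) (ℕ.suc a) b y)
                   (trans (cong (iter (parent T) (ℕ.suc a)) fᵇy≡x) fᵃ⁺¹x≡y))
            (parent-root T) (reaches T y)
    x≡r : x ≡ r
    x≡r = trans (sym fᵇy≡x)
                (trans (cong (iter (parent T) b) y≡r) (iter-fixedPoint (parent T) (parent-root T) b))

  iter-≤⇒InDesc : ∀ {x a b i j} → i ℕ.≤ j →
                  iter (parent T) i x ≡ a → iter (parent T) j x ≡ b → InDesc T a b
  iter-≤⇒InDesc {x} {i = i} {j} i≤j refl fʲx≡b = j ℕ.∸ i , trans (iter-∸ (parent T) x i≤j) fʲx≡b

  InDesc-linear : ∀ {x a b} → InDesc T x a → InDesc T x b → InDesc T a b ⊎ InDesc T b a
  InDesc-linear (i , fⁱx≡a) (j , fʲx≡b) with ℕ.≤-total i j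
  ... | inj₁ i≤j = inj₁ (iter-≤⇒InDesc i≤j fⁱx≡a fʲx≡b)
  ... | inj₂ j≤i = inj₂ (iter-≤⇒InDesc j≤i fʲx≡b fⁱx≡a)

  InDiff : Fin n → Fin n → Fin n → Set
  InDiff u l x = InDesc T x u × ¬ InDesc T x l

  incomparable⇒disjoint : ∀ {v l x} → ¬ InDesc T v l → ¬ InDesc T l v → InDesc T x v → ¬ InDesc T x l
  incomparable⇒disjoint v↓̸l l↓̸v x↓v x↓l = [ v↓̸l , l↓̸v ]′ (InDesc-linear x↓v x↓l)

  subtree⊆InDiff : ∀ {u l v y x} → InDesc T v u → ¬ InDesc T l v → InDiff u l y → InDesc T y v →
                   InDesc T x v → InDiff u l x
  subtree⊆InDiff v↓u l↓̸v (_ , y↓̸l) y↓v x↓v =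
    InDesc-trans x↓v v↓u , incomparable⇒disjoint (y↓̸l ∘ InDesc-trans y↓v) l↓̸v x↓v

  top-InDiff : ∀ {u l} → StrictDesc T l u → InDiff u l u
  top-InDiff {u} (l↓u , l≢u) = InDesc-refl u , λ u↓l → l≢u (InDesc-antisym l↓u u↓l)

  InDiff-injective : ∀ {u l u′ l′} → StrictDesc T l u → StrictDesc T l′ u′ →
                     (∀ {x} → InDiff u l x → InDiff u′ l′ x) → (∀ {x} → InDiff u′ l′ x → InDiff u l x) →
                     u ≡ u′ × l ≡ l′
  InDiff-injective {u} {l} {u′} {l′} l<u l′<u′ ⊆′ ⊇′ = u≡u′ , l≡l′
    where
    u≡u′ : u ≡ u′
    u≡u′ = InDesc-antisym (proj₁ (⊆′ (top-InDiff l<u))) (proj₁ (⊇′ (top-InDiff l′<u′)))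
    l↓l′ : ¬ ¬ InDesc T l l′
    l↓l′ l↓̸l′ = proj₂ (⊇′ (subst (InDesc T l) u≡u′ (proj₁ l<u) , l↓̸l′)) (InDesc-refl l)
    l′↓l : ¬ ¬ InDesc T l′ l
    l′↓l l′↓̸l = proj₂ (⊆′ (subst (InDesc T l′) (sym u≡u′) (proj₁ l′<u′) , l′↓̸l)) (InDesc-refl l′)
    l≡l′ : l ≡ l′
    l≡l′ = decidable-stable (l ≟ l′) λ l≢l′ → l↓l′ λ l↓l′ → l′↓l λ l′↓l → l≢l′ (InDesc-antisym l↓l′ l′↓l)

crossing : Bool → Bool → ℚ → ℚ
crossing a b w = if a xor b then w else 0ℚ

crossing-submodular : ∀ a b c d {w} → 0ℚ ≤ w →
                      crossing (a ∧ c) (b ∧ d) w + crossing (a ∨ c) (b ∨ d) w ≤ crossing a b w + crossing c d w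
crossing-submodular true  true  true  true      _   = ≤-refl
crossing-submodular true  true  true  false {w} _   = ≤-reflexive (+-comm w 0ℚ)
crossing-submodular true  true  false true  {w} _   = ≤-reflexive (+-comm w 0ℚ)
crossing-submodular true  true  false false     _   = ≤-refl
crossing-submodular true  false true  true      _   = ≤-refl
crossing-submodular true  false true  false     _   = ≤-refl
crossing-submodular true  false false true      w≥0 = +-mono-≤ w≥0 w≥0
crossing-submodular true  false false false {w} _   = ≤-reflexive (+-comm 0ℚ w)
crossing-submodular false true  true  true      _   = ≤-refl
crossing-submodular false true  true  false     w≥0 = +-mono-≤ w≥0 w≥0
crossing-submodular false true  false true      _   = ≤-refl
crossing-submodular false true  false false {w} _   = ≤-reflexive (+-comm 0ℚ w)
crossing-submodular false false true  true      _   = ≤-refl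
crossing-submodular false false true  false     _   = ≤-refl
crossing-submodular false false false true      _   = ≤-refl
crossing-submodular false false false false     _   = ≤-refl

does-∈? : ∀ {n} (x : Fin n) (p : Subset n) → does (x ∈? p) ≡ lookup p x
does-∈? zero    (inside  ∷ p) = refl
does-∈? zero    (outside ∷ p) = refl
does-∈? (suc x) (_       ∷ p) = does-∈? x p

crossW-lookup : ∀ {n} (G : Graph n) S i →
                crossW G S i ≡ crossing (lookup S (src G i)) (lookup S (tgt G i)) (w G i)
crossW-lookup G S i =
  trans crossW-does (cong₂ (λ a b → crossing a b (w G i)) (does-∈? (src G i) S) (does-∈? (tgt G i) S))
  where
  crossW-does : crossW G S i ≡ crossing (does (src G i ∈? S)) (does (tgt G i ∈? S)) (w G i)
  crossW-does with src G i ∈? S | tgt G i ∈? S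
  ... | yes _ | yes _ = refl
  ... | yes _ | no  _ = refl
  ... | no  _ | yes _ = refl
  ... | no  _ | no  _ = refl

sumFin-+ : ∀ m (f g : Fin m → ℚ) → sumFin m f + sumFin m g ≡ sumFin m (λ i → f i + g i)
sumFin-+ ℕ.zero    f g = refl
sumFin-+ (ℕ.suc m) f g =
  trans (interchange (f zero) (sumFin m (f ∘ suc)) (g zero) (sumFin m (g ∘ suc)))
        (cong (f zero + g zero +_) (sumFin-+ m (f ∘ suc) (g ∘ suc)))

sumFin-mono : ∀ m {f g : Fin m → ℚ} → (∀ i → f i ≤ g i) → sumFin m f ≤ sumFin m g
sumFin-mono ℕ.zero    f≤g = ≤-refl
sumFin-mono (ℕ.suc m) f≤g = +-mono-≤ (f≤g zero) (sumFin-mono m (f≤g ∘ suc))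

cutWeight-submodular : ∀ {n} (G : Graph n) S S′ →
                       cutWeight G (S ∩ S′) + cutWeight G (S ∪ S′) ≤ cutWeight G S + cutWeight G S′
cutWeight-submodular G S S′ =
  subst₂ _≤_ (sym (sumFin-+ (m G) _ _)) (sym (sumFin-+ (m G) _ _)) (sumFin-mono (m G) edge)
  where
  edge : ∀ i → crossW G (S ∩ S′) i + crossW G (S ∪ S′) i ≤ crossW G S i + crossW G S′ i
  edge i rewrite crossW-lookup G (S ∩ S′) i | crossW-lookup G (S ∪ S′) i
               | crossW-lookup G S i | crossW-lookup G S′ i
               | lookup-zipWith _∧_ (src G i) S S′ | lookup-zipWith _∧_ (tgt G i) S S′
               | lookup-zipWith _∨_ (src G i) S S′ | lookup-zipWith _∨_ (tgt G i) S S′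
    = crossing-submodular (lookup S (src G i)) (lookup S (tgt G i))
                          (lookup S′ (src G i)) (lookup S′ (tgt G i)) (w≥0 G i)

+-cancelʳ-≤ : ∀ {a b} c → a + c ≤ b + c → a ≤ b
+-cancelʳ-≤ {a} {b} c a+c≤b+c =
  subst₂ _≤_ (//-rightDividesʳ c a) (//-rightDividesʳ c b) (+-monoˡ-≤ (- c) a+c≤b+c)

module _ {n : ℕ} (G : Graph n) (r : Fin n) where

  -- Submodularity, with S ∪ S′ a cut no lighter than the mincut S′.
  mincut-∩ : ∀ {S S′} → IsMincut G r S → IsMincut G r S′ → Nonempty (S ∩ S′) → IsMincut G r (S ∩ S′)
  mincut-∩ {S} {S′} ((r∉S , x , x∈S) , S-min) ((r∉S′ , _) , S′-min) S∩S′≢∅ =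
    (r∉S∩S′ , S∩S′≢∅) , λ S″ S″-cut → ≤-trans ∩-lighter (S-min S″ S″-cut)
    where
    r∉S∩S′ : ¬ r ∈ S ∩ S′
    r∉S∩S′ = r∉S ∘ proj₁ ∘ x∈p∩q⁻ S S′
    ∪-cut : IsCut r (S ∪ S′)
    ∪-cut = [ r∉S , r∉S′ ]′ ∘ x∈p∪q⁻ S S′ , x , x∈p∪q⁺ (inj₁ x∈S)
    ∩-lighter : cutWeight G (S ∩ S′) ≤ cutWeight G S
    ∩-lighter = +-cancelʳ-≤ (cutWeight G (S ∪ S′))
      (≤-trans (cutWeight-submodular G S S′) (+-monoʳ-≤ (cutWeight G S) (S′-min (S ∪ S′) ∪-cut)))

  minimalMincut-⊆ : ∀ {e S S′} → IsMinimalMincut G r e S → IsMincut G r S′ →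
                    src G e ∈ S′ → tgt G e ∈ S′ → S ⊆ S′
  minimalMincut-⊆ {e} {S} {S′} (S-mincut , s∈S , t∈S , S-least) S′-mincut s∈S′ t∈S′ {x} x∈S
    with x ∈? S′
  ... | yes x∈S′ = x∈S′
  ... | no  x∉S′ = ⊥-elim (ℕ.<⇒≱ ∣S∩S′∣<∣S∣ (S-least (S ∩ S′) S∩S′-mincut s∈S∩S′ t∈S∩S′))
    where
    s∈S∩S′ : src G e ∈ S ∩ S′
    s∈S∩S′ = x∈p∩q⁺ (s∈S , s∈S′)
    t∈S∩S′ : tgt G e ∈ S ∩ S′
    t∈S∩S′ = x∈p∩q⁺ (t∈S , t∈S′)
    S∩S′-mincut : IsMincut G r (S ∩ S′)
    S∩S′-mincut = mincut-∩ S-mincut S′-mincut (src G e , s∈S∩S′)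
    ∣S∩S′∣<∣S∣ : ∣ S ∩ S′ ∣ ℕ.< ∣ S ∣
    ∣S∩S′∣<∣S∣ = p⊂q⇒∣p∣<∣q∣ (p∩q⊆p S S′ , x , x∈S , x∉S′ ∘ proj₂ ∘ x∈p∩q⁻ S S′)

module _ {n : ℕ} {G : Graph n} {r : Fin n} (T : RootedSpanningTree G r) where

  rightEdge-InDiff-⊆ : ∀ {e₁ u₁ l₁ e₂ u₂ l₂ v} →
                       IsRightEdgeWith T e₁ u₁ l₁ → IsRightEdgeWith T e₂ u₂ l₂ →
                       InDesc T (src G e₁) v → InDesc T (tgt G e₁) v → InDesc T (tgt G e₂) v →
                       InDesc T v u₂ → ¬ InDesc T l₂ v →
                       ∀ {x} → InDiff T u₁ l₁ x → InDiff T u₂ l₂ x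
  rightEdge-InDiff-⊆ {v = v} (S₁ , S₁-minimal , _ , S₁≈) (S₂ , (S₂-mincut , _ , t₂∈S₂ , _) , _ , S₂≈)
                     s₁↓v t₁↓v t₂↓v v↓u₂ l₂↓̸v {x} =
    proj₁ (S₂≈ x) ∘ S₁⊆S₂ ∘ proj₂ (S₁≈ x)
    where
    subtree⊆S₂ : ∀ {y} → InDesc T y v → y ∈ S₂
    subtree⊆S₂ {y} y↓v = proj₂ (S₂≈ y) (subtree⊆InDiff T v↓u₂ l₂↓̸v (proj₁ (S₂≈ _) t₂∈S₂) t₂↓v y↓v)
    S₁⊆S₂ : S₁ ⊆ S₂
    S₁⊆S₂ = minimalMincut-⊆ G r S₁-minimal S₂-mincut (subtree⊆S₂ s₁↓v) (subtree⊆S₂ t₁↓v)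

lemma5p11 : {n : ℕ} (G : Graph n) (r : Fin n) (T : RootedSpanningTree G r) (v : Fin n)
            (e₁ e₂ : Fin (m G)) (u₁ l₁ u₂ l₂ : Fin n) →
            IsRightEdgeWith T e₁ u₁ l₁ → IsRightEdgeWith T e₂ u₂ l₂ →
            InDesc T (src G e₁) v → InDesc T (tgt G e₁) v →
            InDesc T (src G e₂) v → InDesc T (tgt G e₂) v →
            ¬ InDesc T l₁ v → ¬ InDesc T l₂ v →
            InStrictAnc T u₁ v → InStrictAnc T u₂ v →
            (∀ x → (OnPath T u₁ l₁ x → OnPath T u₂ l₂ x) × (OnPath T u₂ l₂ x → OnPath T u₁ l₁ x))
lemma5p11 G r T v e₁ e₂ u₁ l₁ u₂ l₂ R₁@(_ , _ , l₁<u₁ , _) R₂@(_ , _ , l₂<u₂ , _)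
          s₁↓v t₁↓v s₂↓v t₂↓v l₁↓̸v l₂↓̸v (v↓u₁ , _) (v↓u₂ , _)
  with InDiff-injective T l₁<u₁ l₂<u₂
         (rightEdge-InDiff-⊆ T R₁ R₂ s₁↓v t₁↓v t₂↓v v↓u₂ l₂↓̸v)
         (rightEdge-InDiff-⊆ T R₂ R₁ s₂↓v t₂↓v t₁↓v v↓u₁ l₁↓̸v)
... | refl , refl = λ _ → id , id
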